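{- Let $\ell \in \mathbb{N}$, let $G$ be a $2$-connected graph that is $k$-contractible to a graph $T \in \mathbb{T}_\ell$, let $\mathcal{W}$ be a $T$-witness structure of $G$, let $\phi: V(G) \to [2\sqrt{\ell}+2]$ be a $\mathcal{W}$-compatible coloring, and let $\mathcal{X}$ be the set of monochromatic components of $\phi$ (the vertex sets of the connected components of $G[\phi^{ -1}(c)]$, over all colors $c$). Let $T'$ be the graph for which $\mathcal{X}$ is a $T'$-witness structure of $G$ (i.e., the graph obtained by contracting each set of $\mathcal{X}$ to a single vertex). Then $T' \in \mathbb{T}_\ell$ and $|V(T')| \le |V(T)|$.
   Context: All graphs are finite and simple. For $\ell \in \mathbb{N}$, $\mathbb{T}_\ell$ is the class of graphs from which a tree can be obtained by deleting at most $\ell$ edges. $G$ is $k$-contractible to $H$ if $G/S$ is isomorphic to $H$ for some $S \subseteq E(G)$ with $|S| \le k$. An $H$-witness structure of $G$ is a partition $\{W(h) : h \in V(H)\}$ of $V(G)$ with each $G[W(h)]$ connected and $hh' \in E(H)$ iff some edge of $G$ joins $W(h)$ and $W(h')$. Given such $T$ and $\mathcal{W}$, fix a spanning tree $T_S$ of $T$; let $M$ be the set of endpoints of edges in $E(T)\setminus E(T_S)$ together with all vertices of degree at least $3$ in $T$, and $B = \{t \in V(T) : |W(t)| \ge 2\}$. A coloring $\phi$ of $V(G)$ is $\mathcal{W}$-compatible if: (1) every witness set $W \in \mathcal{W}$ is monochromatic; (2) for all adjacent $t,t' \in M\cup B$, $\phi(W(t)) \ne \phi(W(t'))$; (3) for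 all $t,t' \in M \cup B$ (not necessarily distinct) and every path $(t,t_1,\dots,t_z,t')$ in $T$ with $z \ge 1$ and $t_i \notin M\cup B$ for all $i$, we have $\phi(W(t)) \ne \phi(W(t_1))$ and $\phi(W(t_z)) \ne \phi(W(t'))$. Here $\phi(W)$ denotes the common color of a monochromatic set $W$, and $[2\sqrt{\ell}+2]$ denotes a set of $2\sqrt{\ell}+2$ colors. -}

module Defs where

open import Data.Nat using (ℕ; zero; suc; _+_; _*_; _≤_; _<_; _<ᵇ_)
open import Data.Fin using (Fin; toℕ; inject₁; fromℕ)
open import Data.Bool using (Bool; true; false; if_then_else_; _∧_)
open import Data.Product using (Σ; ∃; ∃-syntax; _×_; _,_)
open import Data.Sum using (_⊎_)
open import Data.Unit using (⊤)
open import Relation.Nullary using (¬_)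
open import Relation.Binary.PropositionalEquality using (_≡_; _≢_)

record Graph (n : ℕ) : Set where
  field
    adj    : Fin n → Fin n → Bool
    adj-sym : ∀ u v → adj u v ≡ adj v u
    adj-irr : ∀ u → adj u u ≡ false
open Graph public

Adj : ∀ {n} → Graph n → Fin n → Fin n → Set
Adj G u v = adj G u v ≡ true

count : ∀ {n} → (Fin n → Bool) → ℕ
count {zero}  f = 0
count {suc n} f = (if f Data.Fin.zero then 1 else 0) + count (λ i → f (Data.Fin.suc i))

sumFin : ∀ {n} → (Fin n → ℕ) → ℕ
sumFin {zero}  g = 0
sumFin {suc n} g = g Data.Fin.zero + sumFin (λ i → g (Data.Fin.suc i))

edgeCount : ∀ {n} → Graph n → ℕ
edgeCount G = sumFin (λ i → count (λ j → adj G i j ∧ (toℕ i <ᵇ toℕ j)))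

deg : ∀ {n} → Graph n → Fin n → ℕ
deg G t = count (adj G t)

_⊆G_ : ∀ {n} → Graph n → Graph n → Set
H ⊆G G = ∀ u v → Adj H u v → Adj G u v

-- Walks inside a vertex set P: Reach G P u v means there is a walk
-- from u to v in G all of whose vertices satisfy P (i.e. u and v are in
-- the same component of G[P]).

data Reach {n} (G : Graph n) (P : Fin n → Set) : Fin n → Fin n → Set where
  here : ∀ {u} → P u → Reach G P u u
  step : ∀ {u w v} → P u → Adj G u w → Reach G P w v → Reach G P u v

Connected : ∀ {n} → Graph n → Set
Connected G = ∀ u v → Reach G (λ _ → ⊤) u v

-- 2-connected: at least 3 vertices, connected, and no cut vertex
TwoConnected : ∀ {n} → Graph n → Set
TwoConnected {n} G =
  3 ≤ n × Connected G ×
  (∀ x u v → u ≢ x → v ≢ x → Reach G (λ w → w ≢ x) u v)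

HasCycle : ∀ {n} → Graph n → Set
HasCycle {n} G =
  Σ ℕ λ k → Σ (Fin (suc (suc (suc k))) → Fin n) λ c →
    (∀ i j → c i ≡ c j → i ≡ j) ×
    (∀ (i : Fin (suc (suc k))) → Adj G (c (inject₁ i)) (c (Data.Fin.suc i))) ×
    Adj G (c (fromℕ (suc (suc k)))) (c Data.Fin.zero)

IsTree : ∀ {n} → Graph n → Set
IsTree G = Connected G × ¬ HasCycle G

-- 𝕋_ℓ: a tree can be obtained by deleting at most ℓ edges
InTℓ : ∀ {n} → ℕ → Graph n → Set
InTℓ {n} ℓ G = Σ (Graph n) λ F → F ⊆G G × IsTree F × edgeCount G ≤ edgeCount F + ℓ

IsSpanningTree : ∀ {m} → Graph m → Graph m → Set
IsSpanningTree T TS = TS ⊆G T × IsTree TS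

-- H-witness structures, encoded by the map f : V(G) → V(H) sending each
-- vertex to the index of its witness set, W(h) = f⁻¹(h).

record IsWitness {n m} (G : Graph n) (H : Graph m) (f : Fin n → Fin m) : Set where
  field
    nonempty  : ∀ h → ∃[ u ] f u ≡ h
    connected : ∀ h u v → f u ≡ h → f v ≡ h → Reach G (λ w → f w ≡ h) u v
    adj⇒edge  : ∀ h h' → Adj H h h' → ∃[ u ] ∃[ v ] (f u ≡ h × f v ≡ h' × Adj G u v)
    edge⇒adj  : ∀ u v → Adj G u v → f u ≢ f v → Adj H (f u) (f v)

-- G is k-contractible to H: there is S ⊆ E(G), |S| ≤ k, such that the
-- connected components of (V(G), S) form an H-witness structure of G
-- (i.e. G/S ≅ H).
KContractible : ∀ {n m} → ℕ → Graph n → Graph m → Set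
KContractible {n} {m} k G H =
  Σ (Graph n) λ S → S ⊆G G × edgeCount S ≤ k ×
    Σ (Fin n → Fin m) λ f → IsWitness G H f ×
      (∀ u v → f u ≡ f v → Reach S (λ _ → ⊤) u v) ×
      (∀ u v → Adj S u v → f u ≡ f v)

-- Number of colours: s = ⌊2√ℓ⌋ = ⌊√(4ℓ)⌋, colours are Fin (s + 2).

IsFloorSqrt : ℕ → ℕ → Set
IsFloorSqrt x s = s * s ≤ x × x < suc s * suc s

-- 𝒲-compatible colourings (relative to the witness map f and a fixed
-- spanning tree TS of T)

module _ {n m c : ℕ} (G : Graph n) (T : Graph m) (f : Fin n → Fin m)
         (TS : Graph m) (φ : Fin n → Fin c) where

  InM : Fin m → Set
  InM t = (∃[ t' ] (Adj T t t' × adj TS t t' ≡ false)) ⊎ 3 ≤ deg T t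

  InB : Fin m → Set
  InB t = ∃[ u ] ∃[ v ] (u ≢ v × f u ≡ t × f v ≡ t)

  InMB : Fin m → Set
  InMB t = InM t ⊎ InB t

  DiffCol : Fin m → Fin m → Set
  DiffCol t t' = ∀ u v → f u ≡ t → f v ≡ t' → φ u ≢ φ v

  record Compatible : Set where
    field
      mono : ∀ u v → f u ≡ f v → φ u ≡ φ v
      adjMB : ∀ t t' → InMB t → InMB t' → Adj T t t' → DiffCol t t'
      -- path (t, p 0, …, p z, t') in T with suc z ≥ 1 internal vertices,
      -- all outside M ∪ B and pairwise distinct; if t = t' it is a cycle,
      -- so then at least two internal vertices are required.
      pathMB : ∀ t t' → InMB t → InMB t' →
               (z : ℕ) (p : Fin (suc z) → Fin m) →
               (∀ i j → p i ≡ p j → i ≡ j) →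
               (∀ i → ¬ InMB (p i)) →
               Adj T t (p Data.Fin.zero) →
               (∀ (i : Fin z) → Adj T (p (inject₁ i)) (p (Data.Fin.suc i))) →
               Adj T (p (fromℕ z)) t' →
               (t ≡ t' → 1 ≤ z) →
               DiffCol t (p Data.Fin.zero) × DiffCol (p (fromℕ z)) t'

SameMonoComp : ∀ {n c} → Graph n → (Fin n → Fin c) → Fin n → Fin n → Set
SameMonoComp G φ u v = Reach G (λ w → φ w ≡ φ u) u v

module Submission where

-- The monochromatic components of φ form a witness structure of G that is
-- coarser than 𝒲, because every witness set of 𝒲 is connected and (by
-- compatibility condition (1)) monochromatic.  Hence T' is obtained from T by
-- contracting connected vertex classes, and the theorem is a statement about
-- contractions, proved by counting:
--   * a connected graph H with a vertex lies in 𝕋_ℓ iff |E(H)| < |V(H)| + ℓ,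
--     since a spanning tree has exactly |V| − 1 edges and every tree at most
--     |V| − 1 (spanning-tree, tree-edges, InTℓ⇒edges, edges⇒InTℓ);
--   * contracting connected classes never increases |E| − |V|: the classes of
--     T carry a spanning forest with |V(T)| − |V(T')| edges, found by
--     breadth-first search (ClassForest), and the other edges of T cover
--     those of T' (contraction-edges).

open import Defs
open import Data.Nat using (ℕ; zero; suc; _+_; _*_; _∸_; _≤_; _<_; _<ᵇ_; _<?_; _≤?_; z≤n; s≤s; s≤s⁻¹)
open import Data.Nat.Properties
  using (≤-refl; ≤-trans; ≤-antisym; <-irrefl; <-asym; <-cmp; +-mono-≤; +-monoˡ-≤; +-cancelʳ-≤; +-suc; +-assoc; +-mono-<; +-monoʳ-≤; +-monoʳ-<; +-identityʳ; +-cancelˡ-≡; m+[n∸m]≡n; anyUpTo?; <⇒≱; ≰⇒>; ≤-reflexive; <⇒≤; n≤1+n; module ≤-Reasoning)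
open import Data.Nat.Tactic.RingSolver using (solve-∀)
open import Data.Fin as F using (Fin; toℕ; inject₁; fromℕ; _↑ˡ_; _↑ʳ_; combine)
open import Data.Fin.Properties using (injective⇒≤; any?; toℕ-inject₁; toℕ-fromℕ; toℕ<n; suc-injective; 0≢1+n; +↔⊎; *↔×; splitAt-↑ˡ; splitAt-↑ʳ; remQuot-combine; toℕ-injective)
open import Data.Bool.Properties using (∨-comm; ¬-not) renaming (_≟_ to _≟ᵇ_)
open import Data.Bool using (Bool; true; false; not; _∧_; _∨_; if_then_else_)
open import Data.Product using (Σ; ∃-syntax; _×_; _,_; proj₁; proj₂; uncurry)
open import Data.Sum using (_⊎_; inj₁; inj₂; [_,_])
open import Data.Maybe using (Maybe; just; nothing)
open import Data.Maybe.Properties using (just-injective)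
open import Data.Unit using (⊤; tt)
open import Function using (_∘_)
open import Function.Bundles using (_↔_; _⇔_; Inverse; Equivalence)
open Inverse using (to; from; strictlyInverseˡ; strictlyInverseʳ)
open import Relation.Binary.Definitions using (tri<; tri≈; tri>)
open import Relation.Nullary using (Dec; ¬_; yes; no; does; contradiction)
open import Relation.Nullary.Decidable using (dec-true; dec-false)
open import Relation.Binary.PropositionalEquality hiding ([_])

_==_ : ∀ {n} → Fin n → Fin n → Bool
i == j = does (i F.≟ j)

==⇒≡ : ∀ {n} {i j : Fin n} → (i == j) ≡ true → i ≡ j
==⇒≡ {i = i} {j} e with i F.≟ j
... | yes i≡j = i≡j
... | no _ = contradiction e λ ()

≡⇒== : ∀ {n} {i j : Fin n} → i ≡ j → (i == j) ≡ true
≡⇒== {i = i} {j} = dec-true (i F.≟ j)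

≢⇒== : ∀ {n} {i j : Fin n} → i ≢ j → (i == j) ≡ false
≢⇒== {i = i} {j} = dec-false (i F.≟ j)

==-sym : ∀ {n} (i j : Fin n) → (i == j) ≡ (j == i)
==-sym i j with i F.≟ j
... | yes i≡j = sym (≡⇒== (sym i≡j))
... | no i≢j = sym (≢⇒== (i≢j ∘ sym))

indicator : Bool → ℕ
indicator b = if b then 1 else 0

count-ext : ∀ {n} {P Q : Fin n → Bool} → (∀ i → P i ≡ Q i) → count P ≡ count Q
count-ext {zero} e = refl
count-ext {suc n} e = cong₂ (λ b r → indicator b + r) (e F.zero) (count-ext (e ∘ F.suc))

count-mono : ∀ {n} {P Q : Fin n → Bool} → (∀ i → P i ≡ true → Q i ≡ true) → count P ≤ count Q
count-mono {zero} h = z≤n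
count-mono {suc n} h = +-mono-≤ (indicator-mono (h F.zero)) (count-mono (h ∘ F.suc))
  where
  indicator-mono : ∀ {a b} → (a ≡ true → b ≡ true) → indicator a ≤ indicator b
  indicator-mono {false} _ = z≤n
  indicator-mono {true} a⇒b rewrite a⇒b refl = ≤-refl

count-all : ∀ n → count {n} (λ _ → true) ≡ n
count-all zero = refl
count-all (suc n) = cong suc (count-all n)

count-split : ∀ {n} (P Q : Fin n → Bool) →
  count P ≡ count (λ i → P i ∧ Q i) + count (λ i → P i ∧ not (Q i))
count-split {zero} P Q = refl
count-split {suc n} P Q with P F.zero | Q F.zero | count-split (P ∘ F.suc) (Q ∘ F.suc)
... | false | _     | ih = ih
... | true  | true  | ih = cong suc ih
... | true  | false | ih = trans (cong suc ih) (sym (+-suc _ _))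

count-complement : ∀ {n} (P : Fin n → Bool) → count P + count (not ∘ P) ≡ n
count-complement {n} P = trans (sym (count-split (λ _ → true) P)) (count-all n)

count-remove : ∀ {n} (Q : Fin n → Bool) (q : Fin n) → Q q ≡ true →
  count Q ≡ suc (count (λ j → Q j ∧ not (j == q)))
count-remove Q F.zero Qq rewrite Qq = cong suc (count-ext keep)
  where
  keep : ∀ i → Q (F.suc i) ≡ (Q (F.suc i) ∧ not (F.suc i == F.zero))
  keep i with Q (F.suc i)
  ... | false = refl
  ... | true = refl
count-remove Q (F.suc q) Qq with Q F.zero
... | false = count-remove (Q ∘ F.suc) q Qq
... | true = cong suc (count-remove (Q ∘ F.suc) q Qq)

count-inj : ∀ {a b} {P : Fin a → Bool} {Q : Fin b → Bool}
  (h : ∀ i → P i ≡ true → Fin b) →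
  (∀ i p → Q (h i p) ≡ true) →
  (∀ i j p q → h i p ≡ h j q → i ≡ j) →
  count P ≤ count Q
count-inj {zero} h hQ hinj = z≤n
count-inj {suc a} {P = P} {Q} h hQ hinj with P F.zero in P0
... | false = count-inj (h ∘ F.suc) (hQ ∘ F.suc) (λ i j p q → suc-injective ∘ hinj _ _ p q)
... | true = begin
    suc (count (P ∘ F.suc)) ≤⟨ s≤s (count-inj (h ∘ F.suc) hQ' hinj') ⟩
    suc (count Q')          ≡⟨ count-remove Q q (hQ F.zero P0) ⟨
    count Q                 ∎
  where
  open ≤-Reasoning
  q : Fin _
  q = h F.zero P0
  Q' : Fin _ → Bool
  Q' j = Q j ∧ not (j == q)
  hinj' : ∀ i j p p' → h (F.suc i) p ≡ h (F.suc j) p' → i ≡ j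
  hinj' i j p p' = suc-injective ∘ hinj _ _ p p'
  hQ' : ∀ i p → Q' (h (F.suc i) p) ≡ true
  hQ' i p rewrite ≢⇒== {i = h (F.suc i) p} {q} (λ e → 0≢1+n (hinj F.zero (F.suc i) P0 p (sym e))) | hQ (F.suc i) p = refl

sumFin-ext : ∀ {n} {f g : Fin n → ℕ} → (∀ i → f i ≡ g i) → sumFin f ≡ sumFin g
sumFin-ext {zero} e = refl
sumFin-ext {suc n} e = cong₂ _+_ (e F.zero) (sumFin-ext (e ∘ F.suc))

sumFin-mono : ∀ {n} {f g : Fin n → ℕ} → (∀ i → f i ≤ g i) → sumFin f ≤ sumFin g
sumFin-mono {zero} e = z≤n
sumFin-mono {suc n} e = +-mono-≤ (e F.zero) (sumFin-mono (e ∘ F.suc))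

sumFin-+ : ∀ {n} (f g : Fin n → ℕ) → sumFin (λ i → f i + g i) ≡ sumFin f + sumFin g
sumFin-+ {zero} f g = refl
sumFin-+ {suc n} f g =
  trans (cong (f F.zero + g F.zero +_) (sumFin-+ (f ∘ F.suc) (g ∘ F.suc)))
        (interchange (f F.zero) (g F.zero) _ _)
  where
  interchange : ∀ a b c d → a + b + (c + d) ≡ a + c + (b + d)
  interchange = solve-∀

count-as-sum : ∀ {n} (P : Fin n → Bool) → count P ≡ sumFin (indicator ∘ P)
count-as-sum {zero} P = refl
count-as-sum {suc n} P = cong (indicator (P F.zero) +_) (count-as-sum (P ∘ F.suc))

sum-swap : ∀ {a b} (R : Fin a → Fin b → Bool) →
  sumFin {a} (λ i → count (R i)) ≡ sumFin {b} (λ j → count (λ i → R i j))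
sum-swap {zero} {b} R = sym (sumFin-zero b)
  where
  sumFin-zero : ∀ b → sumFin {b} (λ _ → 0) ≡ 0
  sumFin-zero zero = refl
  sumFin-zero (suc b) = sumFin-zero b
sum-swap {suc a} R = begin
  count (R F.zero) + sumFin (λ i → count (R (F.suc i)))
    ≡⟨ cong₂ _+_ (count-as-sum (R F.zero)) (sum-swap (R ∘ F.suc)) ⟩
  sumFin (λ j → indicator (R F.zero j)) + sumFin (λ j → count (λ i → R (F.suc i) j))
    ≡⟨ sumFin-+ (λ j → indicator (R F.zero j)) (λ j → count (λ i → R (F.suc i) j)) ⟨
  sumFin (λ j → count (λ i → R i j)) ∎
  where open ≡-Reasoning

count-+ : ∀ a {b} (P : Fin (a + b) → Bool) →
  count P ≡ count (λ i → P (i ↑ˡ b)) + count (λ i → P (a ↑ʳ i))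
count-+ zero P = refl
count-+ (suc a) P =
  trans (cong (indicator (P F.zero) +_) (count-+ a (P ∘ F.suc))) (sym (+-assoc (indicator (P F.zero)) _ _))

count-* : ∀ a {b} (P : Fin (a * b) → Bool) →
  count P ≡ sumFin {a} (λ i → count {b} (λ j → P (combine i j)))
count-* zero P = refl
count-* (suc a) {b} P =
  trans (count-+ b P) (cong (count (λ j → P (j ↑ˡ (a * b))) +_) (count-* a (P ∘ (b ↑ʳ_))))

-- Counting on a type A enumerated by Fin a; this transports the injection
-- principle to pairs (Fin a × Fin b) and disjoint unions (Fin a ⊎ Fin b)
countVia : ∀ {a} {A : Set} → Fin a ↔ A → (A → Bool) → ℕ
countVia e P = count (P ∘ to e)

count-inj-via : ∀ {a b} {A B : Set} (e : Fin a ↔ A) (e' : Fin b ↔ B)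
  {P : A → Bool} {Q : B → Bool}
  (h : ∀ x → P x ≡ true → B) →
  (∀ x p → Q (h x p) ≡ true) →
  (∀ x y p q → h x p ≡ h y q → x ≡ y) →
  countVia e P ≤ countVia e' Q
count-inj-via e e' {Q = Q} h hQ hinj =
  count-inj (λ i p → from e' (h (to e i) p))
    (λ i p → subst (λ y → Q y ≡ true) (sym (strictlyInverseˡ e' _)) (hQ _ p))
    (λ i j p q eq → to-injective (hinj _ _ p q (from-injective eq)))
  where
  to-injective : ∀ {i j} → to e i ≡ to e j → i ≡ j
  to-injective {i} {j} eq =
    trans (sym (strictlyInverseʳ e i)) (trans (cong (from e) eq) (strictlyInverseʳ e j))
  from-injective : ∀ {x y} → from e' x ≡ from e' y → x ≡ y
  from-injective {x} {y} eq =
    trans (sym (strictlyInverseˡ e' x)) (trans (cong (to e') eq) (strictlyInverseˡ e' y))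

count-⊎ : ∀ {a b} (P : Fin a → Bool) (Q : Fin b → Bool) →
  count P + count Q ≡ countVia +↔⊎ [ P , Q ]
count-⊎ {a} {b} P Q = sym (trans (count-+ a _)
  (cong₂ _+_ (count-ext λ i → cong [ P , Q ] (splitAt-↑ˡ a i b))
             (count-ext λ i → cong [ P , Q ] (splitAt-↑ʳ a b i))))

true≢false : true ≢ false
true≢false ()

adj⇒≢ : ∀ {m} (H : Graph m) {u v} → Adj H u v → u ≢ v
adj⇒≢ H {u} uv refl = true≢false (trans (sym uv) (adj-irr H u))

arcCount : ∀ {m} → Graph m → ℕ
arcCount H = sumFin (λ i → count (adj H i))

-- arcs counted as pairs, so that the injection principle applies to them
arcCount-via : ∀ {m} (H : Graph m) → arcCount H ≡ countVia *↔× (uncurry (adj H))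
arcCount-via {m} H = sym (trans (count-* m _)
  (sumFin-ext λ i → count-ext λ j → cong (uncurry (adj H)) (remQuot-combine i j)))

<ᵇ-flip : ∀ a b → a ≢ b → not (a <ᵇ b) ≡ (b <ᵇ a)
<ᵇ-flip a b a≢b with <-cmp a b
... | tri< a<b _ b≮a = trans (cong not (dec-true (a <? b) a<b)) (sym (dec-false (b <? a) b≮a))
... | tri≈ _ a≡b _ = contradiction a≡b a≢b
... | tri> a≮b _ b<a = trans (cong not (dec-false (a <? b) a≮b)) (sym (dec-true (b <? a) b<a))

arcCount≡edges : ∀ {m} (H : Graph m) → arcCount H ≡ edgeCount H + edgeCount H
arcCount≡edges H = begin
  sumFin (λ i → count (adj H i))
    ≡⟨ sumFin-ext (λ i → count-split (adj H i) (λ j → toℕ i <ᵇ toℕ j)) ⟩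
  sumFin (λ i → count (λ j → adj H i j ∧ (toℕ i <ᵇ toℕ j)) + count (λ j → adj H i j ∧ not (toℕ i <ᵇ toℕ j)))
    ≡⟨ sumFin-+ _ (λ i → count (λ j → adj H i j ∧ not (toℕ i <ᵇ toℕ j))) ⟩
  edgeCount H + sumFin (λ i → count (λ j → adj H i j ∧ not (toℕ i <ᵇ toℕ j)))
    ≡⟨ cong (edgeCount H +_) (sumFin-ext λ i → count-ext (backward i)) ⟩
  edgeCount H + sumFin (λ i → count (λ j → adj H j i ∧ (toℕ j <ᵇ toℕ i)))
    ≡⟨ cong (edgeCount H +_) (sum-swap (λ i j → adj H j i ∧ (toℕ j <ᵇ toℕ i))) ⟩
  edgeCount H + edgeCount H ∎
  where
  open ≡-Reasoning
  -- an arc i → j with j ≤ i is the reverse of an edge listed at j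
  backward : ∀ i j → (adj H i j ∧ not (toℕ i <ᵇ toℕ j)) ≡ (adj H j i ∧ (toℕ j <ᵇ toℕ i))
  backward i j rewrite adj-sym H i j with adj H j i in ji
  ... | false = refl
  ... | true = <ᵇ-flip (toℕ i) (toℕ j) (adj⇒≢ H ji ∘ sym ∘ toℕ-injective)

edgeCount-mono : ∀ {m} (H G : Graph m) → H ⊆G G → edgeCount H ≤ edgeCount G
edgeCount-mono H G H⊆G = sumFin-mono λ i → count-mono λ j → keep (H⊆G i j)
  where
  keep : ∀ {a b c} → (a ≡ true → b ≡ true) → (a ∧ c) ≡ true → (b ∧ c) ≡ true
  keep {true} a⇒b ac rewrite a⇒b refl = ac

halve-≤ : ∀ {x y} → x + x ≤ y + y → x ≤ y
halve-≤ {x} {y} le with x ≤? y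
... | yes x≤y = x≤y
... | no x≰y = contradiction le (<⇒≱ (+-mono-< (≰⇒> x≰y) (≰⇒> x≰y)))

halve-≡ : ∀ {x y} → x + x ≡ y + y → x ≡ y
halve-≡ e = ≤-antisym (halve-≤ (≤-reflexive e)) (halve-≤ (≤-reflexive (sym e)))

inside : ∀ {m k} → Graph m → (Fin m → Fin k) → Graph m
inside H g = record
  { adj = λ a b → adj H a b ∧ (g a == g b)
  ; adj-sym = λ a b → cong₂ _∧_ (adj-sym H a b) (==-sym (g a) (g b))
  ; adj-irr = λ a → cong (_∧ (g a == g a)) (adj-irr H a) }

across : ∀ {m k} → Graph m → (Fin m → Fin k) → Graph m
across H g = record
  { adj = λ a b → adj H a b ∧ not (g a == g b)
  ; adj-sym = λ a b → cong₂ (λ x y → x ∧ not y) (adj-sym H a b) (==-sym (g a) (g b))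
  ; adj-irr = λ a → cong (_∧ not (g a == g a)) (adj-irr H a) }

arcCount-inside-across : ∀ {m k} (H : Graph m) (g : Fin m → Fin k) →
  arcCount H ≡ arcCount (inside H g) + arcCount (across H g)
arcCount-inside-across H g =
  trans (sumFin-ext (λ i → count-split (adj H i) (λ j → g i == g j)))
        (sumFin-+ (count ∘ adj (inside H g)) (count ∘ adj (across H g)))

module _ {n} (G : Graph n) where

  reach-start : ∀ {P u v} → Reach G P u v → P u
  reach-start (here p) = p
  reach-start (step p _ _) = p

  reach-++ : ∀ {P u v w} → Reach G P u v → Reach G P v w → Reach G P u w
  reach-++ (here _) r' = r'
  reach-++ (step p uw r) r' = step p uw (reach-++ r r')

  reach-sym : ∀ {P u v} → Reach G P u v → Reach G P v u
  reach-sym (here p) = here p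
  reach-sym (step {u} {w} p uw r) =
    reach-++ (reach-sym r) (step (reach-start r) (trans (adj-sym G w u) uw) (here p))

  reach-weaken : ∀ {P Q : Fin n → Set} {u v} → (∀ w → P w → Q w) → Reach G P u v → Reach G Q u v
  reach-weaken P⇒Q (here p) = here (P⇒Q _ p)
  reach-weaken P⇒Q (step p uw r) = step (P⇒Q _ p) uw (reach-weaken P⇒Q r)

-- a walk inside P only uses edges between vertices of P, so it survives
-- in any graph containing those edges
reach-restrict : ∀ {n} {G H : Graph n} {P : Fin n → Set} {u v} →
  (∀ x y → P x → P y → Adj G x y → Adj H x y) → Reach G P u v → Reach H P u v
reach-restrict keep (here p) = here p
reach-restrict {G = G} keep (step p uw r) = step p (keep _ _ p (reach-start G r) uw) (reach-restrict keep r)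

reach-map : ∀ {n m} {G : Graph n} {H : Graph m} (h : Fin n → Fin m) →
  (∀ x y → Adj G x y → h x ≢ h y → Adj H (h x) (h y)) →
  ∀ {P : Fin n → Set} {Q : Fin m → Set} → (∀ w → P w → Q (h w)) →
  ∀ {u v} → Reach G P u v → Reach H Q (h u) (h v)
reach-map h hom P⇒Q (here p) = here (P⇒Q _ p)
reach-map {H = H} h hom {Q = Q} P⇒Q (step {u} {w} {v} p uw r) with h u F.≟ h w
... | yes hu≡hw = subst (λ x → Reach H Q x (h v)) (sym hu≡hw) (reach-map h hom P⇒Q r)
... | no hu≢hw = step (P⇒Q u p) (hom u w uw hu≢hw) (reach-map h hom P⇒Q r)

record Path {n} (H : Graph n) (u v : Fin n) : Set where
  field
    len : ℕ
    vert : ℕ → Fin n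
    starts : vert 0 ≡ u
    ends : vert len ≡ v
    distinct : ∀ i j → i ≤ len → j ≤ len → vert i ≡ vert j → i ≡ j
    steps : ∀ i → i < len → Adj H (vert i) (vert (suc i))

module _ {n} {H : Graph n} where
  open Path

  suffix : ∀ {u v} (π : Path H u v) (i : ℕ) → i ≤ len π → Path H (vert π i) v
  suffix π i i≤len = record
    { len = len π ∸ i
    ; vert = λ j → vert π (i + j)
    ; starts = cong (vert π) (+-identityʳ i)
    ; ends = trans (cong (vert π) (m+[n∸m]≡n i≤len)) (ends π)
    ; distinct = λ j j' j≤ j'≤ eq → +-cancelˡ-≡ i j j' (distinct π _ _ (bound j≤) (bound j'≤) eq)
    ; steps = λ j j< → subst (λ k → Adj H (vert π (i + j)) (vert π k)) (sym (+-suc i j))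
                             (steps π (i + j) (subst (i + j <_) (m+[n∸m]≡n i≤len) (+-monoʳ-< i j<)))
    }
    where
    bound : ∀ {j} → j ≤ len π ∸ i → i + j ≤ len π
    bound j≤ = subst (_ ≤_) (m+[n∸m]≡n i≤len) (+-monoʳ-≤ i j≤)

  cons : ∀ {u w v} → Adj H u w → (π : Path H w v) → (∀ i → i ≤ len π → vert π i ≢ u) → Path H u v
  cons {u} uw π fresh = record
    { len = suc (len π)
    ; vert = vert′
    ; starts = refl
    ; ends = ends π
    ; distinct = distinct′
    ; steps = steps′
    }
    where
    vert′ : ℕ → Fin n
    vert′ zero = u
    vert′ (suc i) = vert π i
    distinct′ : ∀ i j → i ≤ suc (len π) → j ≤ suc (len π) → vert′ i ≡ vert′ j → i ≡ j
    distinct′ zero zero _ _ _ = refl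
    distinct′ zero (suc j) _ (s≤s j≤) eq = contradiction (sym eq) (fresh j j≤)
    distinct′ (suc i) zero (s≤s i≤) _ eq = contradiction eq (fresh i i≤)
    distinct′ (suc i) (suc j) (s≤s i≤) (s≤s j≤) eq = cong suc (distinct π i j i≤ j≤ eq)
    steps′ : ∀ i → i < suc (len π) → Adj H (vert′ i) (vert′ (suc i))
    steps′ zero _ = subst (Adj H u) (sym (starts π)) uw
    steps′ (suc i) (s≤s i<) = steps π i i<

  -- every walk can be shortened to a path: prepend the first vertex, or
  -- cut the path back to where that vertex already occurs
  reach⇒path : ∀ {P u v} → Reach H P u v → Path H u v
  reach⇒path {u = u} (here _) = record
    { len = 0 ; vert = λ _ → u ; starts = refl ; ends = refl
    ; distinct = λ { zero zero _ _ _ → refl } ; steps = λ _ () }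
  reach⇒path {u = u} (step _ uw r) with reach⇒path r
  ... | π with anyUpTo? (λ i → vert π i F.≟ u) (suc (len π))
  ...   | yes (i , s≤s i≤len , πi≡u) = subst (λ x → Path H x _) πi≡u (suffix π i i≤len)
  ...   | no u∉π = cons uw π λ i i≤len πi≡u → u∉π (i , s≤s i≤len , πi≡u)

close-cycle : ∀ {n} (B H : Graph n) → B ⊆G H → ∀ {a b} → Adj H a b → adj B a b ≡ false →
  Path B b a → HasCycle H
close-cycle B H B⊆H {a} {b} ab ab∉B π with Path.len π in len≡ | Path.ends π | Path.steps π
... | zero | ends | _ = contradiction (trans (sym (Path.starts π)) ends) (adj⇒≢ H ab ∘ sym)
... | suc zero | ends | steps = contradiction
      (trans (adj-sym B a b) (subst₂ (Adj B) (Path.starts π) ends (steps 0 (s≤s z≤n)))) (true≢false ∘ λ e → trans (sym e) ab∉B)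
... | suc (suc k) | ends | steps = k , c ,
      (λ i j eq → toℕ-injective (Path.distinct π _ _ (below i) (below j) eq)) ,
      (λ i → subst (λ x → Adj H (c′ x) (c′ (suc (toℕ i)))) (sym (toℕ-inject₁ i))
                   (B⊆H _ _ (steps (toℕ i) (toℕ<n i)))) ,
      subst (λ x → Adj H (c′ x) (c′ 0)) (sym (toℕ-fromℕ (suc (suc k))))
            (subst₂ (Adj H) (sym ends) (sym (Path.starts π)) ab)
  where
  c′ : ℕ → Fin _
  c′ = Path.vert π
  c : Fin (suc (suc (suc k))) → Fin _
  c i = c′ (toℕ i)
  below : ∀ (i : Fin (suc (suc (suc k)))) → toℕ i ≤ Path.len π
  below i = subst (toℕ i ≤_) (sym len≡) (s≤s⁻¹ (toℕ<n i))

acyclic-⊆-connected : ∀ {n} (B H : Graph n) → B ⊆G H → Connected B → ¬ HasCycle H → H ⊆G B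
acyclic-⊆-connected B H B⊆H B-conn acyclic a b ab with adj B a b in ab∈B
... | true = refl
... | false = contradiction (close-cycle B H B⊆H ab ab∈B (reach⇒path (B-conn b a))) acyclic

fromℕ-or-inject₁ : ∀ {n} (i : Fin (suc n)) → i ≡ fromℕ n ⊎ ∃[ j ] i ≡ inject₁ j
fromℕ-or-inject₁ {zero} F.zero = inj₁ refl
fromℕ-or-inject₁ {suc n} F.zero = inj₂ (F.zero , refl)
fromℕ-or-inject₁ {suc n} (F.suc i) with fromℕ-or-inject₁ i
... | inj₁ i≡last = inj₁ (cong F.suc i≡last)
... | inj₂ (j , i≡j) = inj₂ (F.suc j , cong F.suc i≡j)

cycle-neighbours : ∀ {n} (G : Graph n) (k : ℕ) (c : Fin (suc (suc (suc k))) → Fin n) →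
  (∀ (i : Fin (suc (suc k))) → Adj G (c (inject₁ i)) (c (F.suc i))) →
  Adj G (c (fromℕ (suc (suc k)))) (c F.zero) →
  ∀ i → ∃[ a ] ∃[ b ] a ≢ b × Adj G (c i) (c a) × Adj G (c i) (c b)
cycle-neighbours G k c next close i with fromℕ-or-inject₁ i
... | inj₁ refl = F.zero , inject₁ (fromℕ (suc k)) , (λ ()) , close , backwards (fromℕ (suc k))
  where
  backwards : ∀ j → Adj G (c (F.suc j)) (c (inject₁ j))
  backwards j = trans (adj-sym G _ _) (next j)
... | inj₂ (F.zero , refl) =
      F.suc F.zero , fromℕ (suc (suc k)) , (λ ()) , next F.zero , trans (adj-sym G _ _) close
... | inj₂ (F.suc j , refl) =
      F.suc (F.suc j) , inject₁ (inject₁ j) , apart , next (F.suc j) , trans (adj-sym G _ _) (next (inject₁ j))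
  where
  apart : F.suc (F.suc j) ≢ inject₁ (inject₁ j)
  apart eq = <-irrefl refl (subst (toℕ j <_)
    (trans (cong toℕ eq) (trans (toℕ-inject₁ (inject₁ j)) (toℕ-inject₁ j))) (s≤s (n≤1+n (toℕ j))))

argmax : ∀ {n} (f : Fin (suc n) → ℕ) → ∃[ i ] (∀ j → f j ≤ f i)
argmax {zero} f = F.zero , λ { F.zero → ≤-refl }
argmax {suc n} f with argmax (f ∘ F.suc)
... | i , max with f F.zero ≤? f (F.suc i)
...   | yes f0≤ = F.suc i , λ { F.zero → f0≤ ; (F.suc j) → max j }
...   | no f0≰ = F.zero , λ { F.zero → ≤-refl ; (F.suc j) → ≤-trans (max j) (<⇒≤ (≰⇒> f0≰)) }

-- A rooted spanning forest of H: every non-root vertex has a parent, adjacent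
-- to it in H and of smaller rank; ranks make the parent relation well-founded
record RootedForest {m} (H : Graph m) : Set where
  field
    isRoot : Fin m → Bool
    rank : Fin m → ℕ
    parent : Fin m → Fin m
    parent-adj : ∀ v → isRoot v ≡ false → Adj H v (parent v)
    parent-rank : ∀ v → isRoot v ≡ false → rank (parent v) < rank v

not-true : ∀ {b} → not b ≡ true → b ≡ false
not-true {false} _ = refl

module RootedForestFacts {m} {H : Graph m} (R : RootedForest H) where
  open RootedForest R

  nonroot : Fin m → Bool
  nonroot = not ∘ isRoot

  reaches-root : ∀ v → ∃[ r ] isRoot r ≡ true × Reach H (λ _ → ⊤) v r
  reaches-root v = climb (suc (rank v)) v ≤-refl
    where
    climb : ∀ b v → rank v < b → ∃[ r ] isRoot r ≡ true × Reach H (λ _ → ⊤) v r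
    climb (suc b) v (s≤s rank≤b) with isRoot v in root?
    ... | true = v , root? , here tt
    ... | false with climb b (parent v) (≤-trans (parent-rank v root?) rank≤b)
    ...   | r , root-r , to-r = r , root-r , step tt (parent-adj v root?) to-r

  roots-≤ : ∀ {k} (c : Fin m → Fin k) →
    (∀ x y → isRoot x ≡ true → isRoot y ≡ true → c x ≡ c y → x ≡ y) → count isRoot ≤ k
  roots-≤ {k} c separates =
    subst (count isRoot ≤_) (count-all k) (count-inj (λ v _ → c v) (λ _ _ → refl) separates)

  -- the arcs (v, parent v) and (parent v, v), over all non-roots v, are distinct
  arcs-≥ : count nonroot + count nonroot ≤ arcCount H
  arcs-≥ = begin
    count nonroot + count nonroot         ≡⟨ count-⊎ nonroot nonroot ⟩
    countVia +↔⊎ [ nonroot , nonroot ]    ≤⟨ count-inj-via +↔⊎ *↔× {Q = uncurry (adj H)} parentArc parentArc-adj parentArc-inj ⟩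
    countVia *↔× (uncurry (adj H))        ≡⟨ arcCount-via H ⟨
    arcCount H                            ∎
    where
    open ≤-Reasoning
    parentArc : (x : Fin m ⊎ Fin m) → [ nonroot , nonroot ] x ≡ true → Fin m × Fin m
    parentArc (inj₁ v) _ = v , parent v
    parentArc (inj₂ v) _ = parent v , v
    parentArc-adj : ∀ x p → uncurry (adj H) (parentArc x p) ≡ true
    parentArc-adj (inj₁ v) p = parent-adj v (not-true p)
    parentArc-adj (inj₂ v) p = trans (adj-sym H (parent v) v) (parent-adj v (not-true p))
    -- v = parent w and w = parent v would make both ranks smaller than the other
    no-2-cycle : ∀ v w → nonroot v ≡ true → nonroot w ≡ true → v ≡ parent w → parent v ≢ w
    no-2-cycle v w p q v≡pw pv≡w = <-asym (subst (λ x → rank x < rank v) pv≡w (parent-rank v (not-true p)))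
                                         (subst (λ x → rank x < rank w) (sym v≡pw) (parent-rank w (not-true q)))
    parentArc-inj : ∀ x y p q → parentArc x p ≡ parentArc y q → x ≡ y
    parentArc-inj (inj₁ v) (inj₁ w) p q eq = cong inj₁ (cong proj₁ eq)
    parentArc-inj (inj₂ v) (inj₂ w) p q eq = cong inj₂ (cong proj₂ eq)
    parentArc-inj (inj₁ v) (inj₂ w) p q eq = contradiction (cong proj₂ eq) (no-2-cycle v w p q (cong proj₁ eq))
    parentArc-inj (inj₂ v) (inj₁ w) p q eq = contradiction (sym (cong proj₂ eq)) (no-2-cycle w v q p (sym (cong proj₁ eq)))

module ForestGraph {m} {H : Graph m} (R : RootedForest H) where
  open RootedForest R
  open RootedForestFacts R using (nonroot)

  childOf : Fin m → Fin m → Bool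
  childOf x y = nonroot x ∧ (parent x == y)

  childOf-sound : ∀ {x y} → childOf x y ≡ true → isRoot x ≡ false × parent x ≡ y
  childOf-sound {x} e with isRoot x
  ... | false = refl , ==⇒≡ e

  childOf-parent : ∀ {v} → isRoot v ≡ false → childOf v (parent v) ≡ true
  childOf-parent {v} nr rewrite nr = ≡⇒== {i = parent v} refl

  childOf-irr : ∀ x → childOf x x ≡ false
  childOf-irr x with isRoot x in root?
  ... | true = refl
  ... | false = ≢⇒== λ px≡x → <-irrefl (cong rank px≡x) (parent-rank x root?)

  forestGraph : Graph m
  forestGraph = record
    { adj = λ x y → childOf x y ∨ childOf y x
    ; adj-sym = λ x y → ∨-comm (childOf x y) (childOf y x)
    ; adj-irr = λ x → cong₂ _∨_ (childOf-irr x) (childOf-irr x) }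

  forest-edge : ∀ {x y} → Adj forestGraph x y →
    (isRoot x ≡ false × parent x ≡ y) ⊎ (isRoot y ≡ false × parent y ≡ x)
  forest-edge {x} {y} xy with childOf x y in x→y
  ... | true = inj₁ (childOf-sound x→y)
  ... | false = inj₂ (childOf-sound xy)

  forestGraph-⊆ : forestGraph ⊆G H
  forestGraph-⊆ x y xy with forest-edge xy
  ... | inj₁ (nr , refl) = parent-adj x nr
  ... | inj₂ (nr , refl) = trans (adj-sym H x y) (parent-adj y nr)

  forestGraph-forest : RootedForest forestGraph
  forestGraph-forest = record
    { isRoot = isRoot ; rank = rank ; parent = parent
    ; parent-adj = λ v nr → cong (_∨ childOf (parent v) v) (childOf-parent nr)
    ; parent-rank = parent-rank }

  -- each arc of forestGraph is (v, parent v) or (parent v, v) for a non-root v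
  forestGraph-arcs-≤ : arcCount forestGraph ≤ count nonroot + count nonroot
  forestGraph-arcs-≤ = begin
    arcCount forestGraph                        ≡⟨ arcCount-via forestGraph ⟩
    countVia *↔× (uncurry (adj forestGraph))   ≤⟨ count-inj-via *↔× +↔⊎ {Q = [ nonroot , nonroot ]} child child-nonroot child-inj ⟩
    countVia +↔⊎ [ nonroot , nonroot ]          ≡⟨ count-⊎ nonroot nonroot ⟨
    count nonroot + count nonroot               ∎
    where
    open ≤-Reasoning
    child : (e : Fin m × Fin m) → uncurry (adj forestGraph) e ≡ true → Fin m ⊎ Fin m
    child (x , y) _ with childOf x y
    ... | true = inj₁ x
    ... | false = inj₂ y
    child-nonroot : ∀ e p → [ nonroot , nonroot ] (child e p) ≡ true
    child-nonroot (x , y) p with childOf x y in x→y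
    ... | true = cong not (proj₁ (childOf-sound x→y))
    ... | false = cong not (proj₁ (childOf-sound p))
    child-inj : ∀ e e' p p' → child e p ≡ child e' p' → e ≡ e'
    child-inj (x , y) (x' , y') p p' eq with childOf x y in x→y | childOf x' y' in x'→y'
    child-inj (x , y) (.x , y') p p' refl | true | true =
      cong (x ,_) (trans (sym (proj₂ (childOf-sound x→y))) (proj₂ (childOf-sound x'→y')))
    child-inj (x , y) (x' , .y) p p' refl | false | false =
      cong (_, y) (trans (sym (proj₂ (childOf-sound p))) (proj₂ (childOf-sound p')))

  lower-neighbour : ∀ {x y} → Adj forestGraph x y → rank y ≤ rank x → parent x ≡ y
  lower-neighbour xy rank≤ with forest-edge xy
  ... | inj₁ (_ , px≡y) = px≡y
  ... | inj₂ (nr , refl) = contradiction rank≤ (<⇒≱ (parent-rank _ nr))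

  -- on a cycle, the vertex of maximal rank would have two different parents
  forestGraph-acyclic : ¬ HasCycle forestGraph
  forestGraph-acyclic (k , c , c-inj , next , close) with argmax (rank ∘ c)
  ... | i , max with cycle-neighbours forestGraph k c next close i
  ...   | a , b , a≢b , i~a , i~b =
          a≢b (c-inj a b (trans (sym (lower-neighbour i~a (max a))) (lower-neighbour i~b (max b))))

  forestGraph-arcs : arcCount forestGraph ≡ count nonroot + count nonroot
  forestGraph-arcs = ≤-antisym forestGraph-arcs-≤ (RootedForestFacts.arcs-≥ forestGraph-forest)

dec-witness : ∀ {A : Set} (d : Dec A) → does d ≡ true → A
dec-witness (yes a) _ = a

first : ∀ {m} → (Fin m → Bool) → Maybe (Fin m)
first {zero} p = nothing
first {suc m} p = if p F.zero then just F.zero else Data.Maybe.map F.suc (first (p ∘ F.suc))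

first-found : ∀ {m} (p : Fin m → Bool) v → p v ≡ true → ∃[ u ] first p ≡ just u × p u ≡ true
first-found {suc m} p v pv with p F.zero in p0
... | true = F.zero , refl , p0
first-found {suc m} p F.zero pv | false = contradiction (trans (sym pv) p0) true≢false
first-found {suc m} p (F.suc v) pv | false with first-found (p ∘ F.suc) v pv
... | u , found , pu rewrite found = F.suc u , refl , pu

least : (p : ℕ → Bool) (L : ℕ) → p L ≡ true → ∃[ i ] p i ≡ true × (∀ j → p j ≡ true → i ≤ j)
least p zero pL = 0 , pL , λ _ _ → z≤n
least p (suc L) pL with p 0 in p0
... | true = 0 , p0 , λ _ _ → z≤n
... | false with least (p ∘ suc) L pL
...   | i , pi , minimal = suc i , pi , below
  where
  below : ∀ j → p j ≡ true → suc i ≤ j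
  below zero pj = contradiction (trans (sym pj) p0) true≢false
  below (suc j) pj = s≤s (minimal j pj)

-- If each colour class of c induces a connected subgraph of H, a breadth-first
-- search from the first vertex of every class yields a rooted spanning forest
-- whose roots have pairwise distinct colours.
module ClassForest {m k} (H : Graph m) (c : Fin m → Fin k)
  (classes-connected : ∀ u v → c u ≡ c v → Reach H (λ w → c w ≡ c u) u v) where

  -- the leader of v is the first vertex of its colour class; it depends only on c v
  leaderInfo : ∀ v → ∃[ u ] first (λ x → c x == c v) ≡ just u × (c u == c v) ≡ true
  leaderInfo v = first-found (λ x → c x == c v) v (≡⇒== {i = c v} refl)

  leader : Fin m → Fin m
  leader v = proj₁ (leaderInfo v)

  leader-colour : ∀ v → c (leader v) ≡ c v
  leader-colour v = ==⇒≡ (proj₂ (proj₂ (leaderInfo v)))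

  leader-unique : ∀ v w → c v ≡ c w → leader v ≡ leader w
  leader-unique v w cv≡cw = just-injective (begin
    just (leader v)                ≡⟨ proj₁ (proj₂ (leaderInfo v)) ⟨
    first (λ x → c x == c v)       ≡⟨ cong (λ col → first (λ x → c x == col)) cv≡cw ⟩
    first (λ x → c x == c w)       ≡⟨ proj₁ (proj₂ (leaderInfo w)) ⟩
    just (leader w)                ∎)
    where open ≡-Reasoning

  -- layer r i w: w lies in the colour class of r at distance at most i from r
  layer : Fin m → ℕ → Fin m → Bool
  layer r zero w = w == r
  layer r (suc i) w =
    layer r i w ∨ (c w == c r ∧ does (any? λ x → (layer r i x ∧ adj H x w) ≟ᵇ true))

  layer-colour : ∀ r i w → layer r i w ≡ true → c w ≡ c r
  layer-colour r zero w w∈ = cong c (==⇒≡ w∈)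
  layer-colour r (suc i) w w∈ with layer r i w in w∈i
  ... | true = layer-colour r i w w∈i
  ... | false with c w == c r in same
  ...   | true = ==⇒≡ same

  layer-step : ∀ r j w → layer r (suc j) w ≡ true → layer r j w ≡ false →
    ∃[ x ] layer r j x ≡ true × Adj H w x
  layer-step r j w w∈ w∉ with layer r j w | w∉
  ... | false | refl with c w == c r
  ...   | true with dec-witness (any? λ x → (layer r j x ∧ adj H x w) ≟ᵇ true) w∈
  ...     | x , x∈ = x , ∧-left x∈ , trans (adj-sym H w x) (∧-right x∈)
    where
    ∧-left : ∀ {a b} → (a ∧ b) ≡ true → a ≡ true
    ∧-left {true} _ = refl
    ∧-right : ∀ {a b} → (a ∧ b) ≡ true → b ≡ true
    ∧-right {true} ab = ab

  reach⇒layer : ∀ r {u v} → Reach H (λ w → c w ≡ c r) u v → ∀ i → layer r i u ≡ true →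
    ∃[ L ] layer r L v ≡ true
  reach⇒layer r (here _) i u∈ = i , u∈
  reach⇒layer r (step {u} {w} _ uw rest) i u∈ =
    reach⇒layer r rest (suc i) (∨-right (layer r i w) (cong₂ _∧_ (≡⇒== (reach-start H rest)) found))
    where
    ∨-right : ∀ a {b} → b ≡ true → (a ∨ b) ≡ true
    ∨-right true _ = refl
    ∨-right false b = b
    found : does (any? λ x → (layer r i x ∧ adj H x w) ≟ᵇ true) ≡ true
    found = dec-true (any? λ x → (layer r i x ∧ adj H x w) ≟ᵇ true) (u , cong₂ _∧_ u∈ uw)

  -- the rank of v is its distance from its leader
  rankInfo : ∀ v → ∃[ i ] layer (leader v) i v ≡ true × (∀ j → layer (leader v) j v ≡ true → i ≤ j)
  rankInfo v with reach⇒layer (leader v) (classes-connected (leader v) v (leader-colour v)) 0 (≡⇒== {i = leader v} refl)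
  ... | L , v∈L = least (λ i → layer (leader v) i v) L v∈L

  rank : Fin m → ℕ
  rank v = proj₁ (rankInfo v)

  isRoot : Fin m → Bool
  isRoot v = leader v == v

  towards-leader : ∀ v →
    leader v ≡ v ⊎ ∃[ x ] Adj H v x × ∃[ j ] suc j ≡ rank v × layer (leader v) j x ≡ true
  towards-leader v with rankInfo v
  ... | zero , v∈0 , _ = inj₁ (sym (==⇒≡ v∈0))
  ... | suc j , v∈ , minimal
      with layer-step (leader v) j v v∈ (¬-not λ v∈j → <-irrefl refl (minimal j v∈j))
  ...   | x , x∈ , vx = inj₂ (x , vx , j , refl , x∈)

  parent : Fin m → Fin m
  parent v = [ (λ _ → v) , proj₁ ] (towards-leader v)

  parent-spec : ∀ v → isRoot v ≡ false → Adj H v (parent v) × rank (parent v) < rank v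
  parent-spec v nr with towards-leader v
  ... | inj₁ leader≡v = contradiction (trans (sym (≡⇒== leader≡v)) nr) true≢false
  ... | inj₂ (x , vx , j , sj≡rank , x∈) = vx , subst (rank x <_) sj≡rank (s≤s rank-x≤j)
    where
    same-leader : leader x ≡ leader v
    same-leader = leader-unique x v (trans (layer-colour (leader v) j x x∈) (leader-colour v))
    rank-x≤j : rank x ≤ j
    rank-x≤j = proj₂ (proj₂ (rankInfo x)) j (subst (λ r → layer r j x ≡ true) (sym same-leader) x∈)

  forest : RootedForest H
  forest = record
    { isRoot = isRoot ; rank = rank ; parent = parent
    ; parent-adj = λ v nr → proj₁ (parent-spec v nr)
    ; parent-rank = λ v nr → proj₂ (parent-spec v nr) }

  roots-separated : ∀ x y → isRoot x ≡ true → isRoot y ≡ true → c x ≡ c y → x ≡ y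
  roots-separated x y rx ry cx≡cy = trans (sym (==⇒≡ rx)) (trans (leader-unique x y cx≡cy) (==⇒≡ ry))

spanning-tree : ∀ {m} (H : Graph m) → Connected H → Fin m →
  Σ (Graph m) λ B → B ⊆G H × IsTree B × suc (edgeCount B) ≡ m
spanning-tree {m} H connected v₀ =
  forestGraph , forestGraph-⊆ , (B-connected , forestGraph-acyclic) , size
  where
  -- a single colour class containing every vertex
  open ClassForest H (λ _ → F.zero {0}) (λ u v _ → reach-weaken H (λ _ _ → refl) (connected u v))
  open RootedForestFacts forest
  open ForestGraph forest
  B-connected : Connected forestGraph
  B-connected u v with RootedForestFacts.reaches-root forestGraph-forest u
                     | RootedForestFacts.reaches-root forestGraph-forest v
  ... | r , root-r , u→r | r' , root-r' , v→r' =
    reach-++ forestGraph u→r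
      (subst (λ x → Reach forestGraph _ x v) (roots-separated r' r root-r' root-r refl) (reach-sym forestGraph v→r'))
  one-root : count isRoot ≡ 1
  one-root with reaches-root v₀
  ... | r , root-r , _ = ≤-antisym (roots-≤ _ roots-separated)
                           (subst (1 ≤_) (sym (count-remove isRoot r root-r)) (s≤s z≤n))
  size : suc (edgeCount forestGraph) ≡ m
  size = begin
    suc (edgeCount forestGraph)  ≡⟨ cong suc (halve-≡ (trans (sym (arcCount≡edges forestGraph)) forestGraph-arcs)) ⟩
    suc (count nonroot)          ≡⟨ cong (_+ count nonroot) one-root ⟨
    count isRoot + count nonroot ≡⟨ count-complement isRoot ⟩
    m                            ∎
    where open ≡-Reasoning

tree-edges : ∀ {m} (F : Graph m) → IsTree F → Fin m → suc (edgeCount F) ≤ m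
tree-edges F (connected , acyclic) v₀ with spanning-tree F connected v₀
... | B , B⊆F , (B-connected , _) , size =
  subst (suc (edgeCount F) ≤_) size (s≤s (edgeCount-mono F B (acyclic-⊆-connected B F B⊆F B-connected acyclic)))

InTℓ⇒edges : ∀ {m} ℓ (H : Graph m) → InTℓ ℓ H → Fin m → suc (edgeCount H) ≤ m + ℓ
InTℓ⇒edges ℓ H (F , _ , F-tree , edges≤) v₀ = begin
  suc (edgeCount H)         ≤⟨ s≤s edges≤ ⟩
  suc (edgeCount F) + ℓ     ≤⟨ +-monoˡ-≤ ℓ (tree-edges F F-tree v₀) ⟩
  _ + ℓ                     ∎
  where open ≤-Reasoning

edges⇒InTℓ : ∀ {m} ℓ (H : Graph m) → Connected H → Fin m → suc (edgeCount H) ≤ m + ℓ → InTℓ ℓ H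
edges⇒InTℓ ℓ H connected v₀ bound with spanning-tree H connected v₀
... | B , B⊆H , B-tree , size =
  B , B⊆H , B-tree , s≤s⁻¹ (subst (λ x → suc (edgeCount H) ≤ x + ℓ) (sym size) bound)

module WitnessFacts {n m} {G : Graph n} {H : Graph m} {f : Fin n → Fin m} (W : IsWitness G H f) where
  open IsWitness W

  representative : Fin m → Fin n
  representative h = proj₁ (nonempty h)

  representative-in : ∀ h → f (representative h) ≡ h
  representative-in h = proj₂ (nonempty h)

  -- witness sets are nonempty and disjoint, so H has at most as many vertices as G
  witness-size : m ≤ n
  witness-size = injective⇒≤ λ {x} {y} eq →
    trans (sym (representative-in x)) (trans (cong f eq) (representative-in y))

  witness-connected : Connected G → Connected H
  witness-connected connected x y =
    subst₂ (Reach H (λ _ → ⊤)) (representative-in x) (representative-in y)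
      (reach-map f edge⇒adj (λ _ _ → tt) (connected (representative x) (representative y)))

module Refinement {n m m'} {G : Graph n} {T : Graph m} {T' : Graph m'} {f : Fin n → Fin m} {f' : Fin n → Fin m'}
  (W : IsWitness G T f) (W' : IsWitness G T' f') (refines : ∀ u v → f u ≡ f v → f' u ≡ f' v) where
  private
    module W = IsWitness W
    module W' = IsWitness W'
  open WitnessFacts W
  open WitnessFacts W' using () renaming (representative to representative'; representative-in to representative-in')

  g : Fin m → Fin m'
  g t = f' (representative t)

  g∘f : ∀ u → g (f u) ≡ f' u
  g∘f u = refines (representative (f u)) u (representative-in (f u))

  g-witness : IsWitness T T' g
  g-witness = record
    { nonempty = λ y → f (representative' y) , trans (g∘f _) (representative-in' y)
    ; connected = λ y a b ga≡y gb≡y →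
        subst₂ (Reach T (λ t → g t ≡ y)) (representative-in a) (representative-in b)
          (reach-map f W.edge⇒adj (λ w f'w≡y → trans (g∘f w) f'w≡y)
            (W'.connected y (representative a) (representative b) ga≡y gb≡y))
    ; adj⇒edge = adj⇒edge
    ; edge⇒adj = edge⇒adj }
    where
    adj⇒edge : ∀ x y → Adj T' x y → ∃[ a ] ∃[ b ] (g a ≡ x × g b ≡ y × Adj T a b)
    adj⇒edge x y xy with W'.adj⇒edge x y xy
    ... | u , v , f'u≡x , f'v≡y , uv =
      f u , f v , trans (g∘f u) f'u≡x , trans (g∘f v) f'v≡y ,
      W.edge⇒adj u v uv λ fu≡fv → adj⇒≢ T' xy (trans (sym f'u≡x) (trans (refines u v fu≡fv) f'v≡y))
    edge⇒adj : ∀ a b → Adj T a b → g a ≢ g b → Adj T' (g a) (g b)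
    edge⇒adj a b ab ga≢gb with W.adj⇒edge a b ab
    ... | u , v , refl , refl , uv =
      subst₂ (Adj T') (sym (g∘f u)) (sym (g∘f v))
        (W'.edge⇒adj u v uv λ f'u≡f'v → ga≢gb (trans (g∘f u) (trans f'u≡f'v (sym (g∘f v)))))

-- Contracting connected vertex classes of T loses at least as many edges as
-- vertices: the classes span a forest inside T with m - (number of classes)
-- edges, and the remaining edges of T map onto those of T'.
contraction-edges : ∀ {m m'} {T : Graph m} {T' : Graph m'} {g : Fin m → Fin m'} →
  IsWitness T T' g → edgeCount T' + m ≤ edgeCount T + m'
contraction-edges {m} {m'} {T} {T'} {g} W = halve-≤ (begin
  (edgeCount T' + m) + (edgeCount T' + m)
    ≡⟨ shuffle (edgeCount T') m ⟩
  (edgeCount T' + edgeCount T') + (m + m)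
    ≡⟨ cong₂ (λ a s → a + (s + s)) (arcCount≡edges T') (count-complement isRoot) ⟨
  arcCount T' + ((count isRoot + count nonroot) + (count isRoot + count nonroot))
    ≤⟨ +-mono-≤ cross-arcs (+-mono-≤ (+-monoˡ-≤ _ roots≤) (+-monoˡ-≤ _ roots≤)) ⟩
  arcCount (across T g) + ((m' + count nonroot) + (m' + count nonroot))
    ≡⟨ rearrange (arcCount (across T g)) m' (count nonroot) ⟩
  (count nonroot + count nonroot + arcCount (across T g)) + (m' + m')
    ≤⟨ +-monoˡ-≤ (m' + m') (+-monoˡ-≤ _ arcs-≥) ⟩
  (arcCount (inside T g) + arcCount (across T g)) + (m' + m')
    ≡⟨ cong (_+ (m' + m')) (trans (sym (arcCount-inside-across T g)) (arcCount≡edges T)) ⟩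
  (edgeCount T + edgeCount T) + (m' + m')
    ≡⟨ shuffle (edgeCount T) m' ⟨
  (edgeCount T + m') + (edgeCount T + m') ∎)
  where
  open ≤-Reasoning
  open IsWitness W
  shuffle : ∀ a b → (a + b) + (a + b) ≡ (a + a) + (b + b)
  shuffle = solve-∀
  rearrange : ∀ a b c → a + ((b + c) + (b + c)) ≡ (c + c + a) + (b + b)
  rearrange = solve-∀
  class-connected : ∀ u v → g u ≡ g v → Reach (inside T g) (λ w → g w ≡ g u) u v
  class-connected u v gu≡gv = reach-restrict
    (λ x y gx≡ gy≡ xy → cong₂ _∧_ xy (≡⇒== (trans gx≡ (sym gy≡))))
    (connected (g u) u v refl (sym gu≡gv))
  open ClassForest (inside T g) g class-connected
  open RootedForestFacts forest
  roots≤ : count isRoot ≤ m'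
  roots≤ = roots-≤ g roots-separated
  -- an arc (x, y) of T' comes from an arc of T between the classes x and y
  cross-arcs : arcCount T' ≤ arcCount (across T g)
  cross-arcs = begin
    arcCount T'                                    ≡⟨ arcCount-via T' ⟩
    countVia *↔× (uncurry (adj T'))                 ≤⟨ count-inj-via *↔× *↔× {Q = uncurry (adj (across T g))} lift lift-across lift-inj ⟩
    countVia *↔× (uncurry (adj (across T g)))       ≡⟨ arcCount-via (across T g) ⟨
    arcCount (across T g)                          ∎
    where
    lift : (e : Fin m' × Fin m') → uncurry (adj T') e ≡ true → Fin m × Fin m
    lift (x , y) xy = proj₁ (adj⇒edge x y xy) , proj₁ (proj₂ (adj⇒edge x y xy))
    lift-classes : ∀ x y xy → (g (proj₁ (lift (x , y) xy)) ≡ x) × (g (proj₂ (lift (x , y) xy)) ≡ y)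
    lift-classes x y xy = let (_ , _ , ga , gb , _) = adj⇒edge x y xy in ga , gb
    lift-across : ∀ e p → uncurry (adj (across T g)) (lift e p) ≡ true
    lift-across (x , y) xy with adj⇒edge x y xy
    ... | a , b , refl , refl , ab = cong₂ (λ p q → p ∧ not q) ab (≢⇒== (adj⇒≢ T' xy))
    lift-inj : ∀ e e' p p' → lift e p ≡ lift e' p' → e ≡ e'
    lift-inj (x , y) (x' , y') p p' eq = cong₂ _,_
      (trans (sym (proj₁ (lift-classes x y p))) (trans (cong (g ∘ proj₁) eq) (proj₁ (lift-classes x' y' p'))))
      (trans (sym (proj₂ (lift-classes x y p))) (trans (cong (g ∘ proj₂) eq) (proj₂ (lift-classes x' y' p'))))

-- the excess |E| − |V| does not grow under contraction, and it is below ℓ for T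
excess-transfer : ∀ {e e' m m' ℓ} → e' + m ≤ e + m' → suc e ≤ m + ℓ → suc e' ≤ m' + ℓ
excess-transfer {e} {e'} {m} {m'} {ℓ} contraction bound = +-cancelʳ-≤ m (suc e') (m' + ℓ) (begin
  suc e' + m   ≤⟨ s≤s contraction ⟩
  suc e + m'   ≤⟨ +-monoˡ-≤ m' bound ⟩
  m + ℓ + m'   ≡⟨ reorder m ℓ m' ⟩
  m' + ℓ + m   ∎)
  where
  open ≤-Reasoning
  reorder : ∀ a b c → a + b + c ≡ c + b + a
  reorder = solve-∀

-- T' is a contraction of T, so it keeps |E| − |V| < ℓ and has at most |V(T)| vertices;
-- of the compatibility conditions only (1), monochromatic witness sets, is needed
mainTheorem8 : (ℓ k : ℕ) {n m : ℕ} (G : Graph n) (T : Graph m) →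
    TwoConnected G → KContractible k G T → InTℓ ℓ T →
    (f : Fin n → Fin m) → IsWitness G T f →
    (TS : Graph m) → IsSpanningTree T TS →
    (s : ℕ) → IsFloorSqrt (4 * ℓ) s →
    (φ : Fin n → Fin (s + 2)) → Compatible G T f TS φ →
    {m' : ℕ} (T' : Graph m') (f' : Fin n → Fin m') → IsWitness G T' f' →
    (∀ u v → (f' u ≡ f' v) ⇔ SameMonoComp G φ u v) →
    InTℓ ℓ T' × m' ≤ m
mainTheorem8 ℓ k G T (3≤n , G-connected , _) _ T∈𝕋ℓ f W TS _ s _ φ compatible T' f' W' components =
  edges⇒InTℓ ℓ T' (WitnessFacts.witness-connected W' G-connected) (f' v₀) T'-edges ,
  WitnessFacts.witness-size g-witness
  where
  v₀ : Fin _
  v₀ = F.fromℕ< (≤-trans (s≤s z≤n) 3≤n)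
  -- each witness set is connected and monochromatic, hence inside one monochromatic component
  refines : ∀ u v → f u ≡ f v → f' u ≡ f' v
  refines u v fu≡fv = Equivalence.from (components u v)
    (reach-weaken G (λ w fw≡fu → Compatible.mono compatible w u fw≡fu)
      (IsWitness.connected W (f u) u v refl (sym fu≡fv)))
  open Refinement W W' refines
  T'-edges : suc (edgeCount T') ≤ _ + ℓ
  T'-edges = excess-transfer (contraction-edges g-witness) (InTℓ⇒edges ℓ T T∈𝕋ℓ (f v₀))
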